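{- Let $n>1$. Define $AI_n\colon\mathbb{F}_2^n\to\mathbb{F}_2^{2^n}$ by $AI_n(\mathbf x)=(I_{\mathbf z}(\mathbf x))_{\mathbf z\in\mathbb{F}_2^n}$, where $I_{\mathbf z}(\mathbf x)=1$ if $\mathbf x=\mathbf z$ and $0$ otherwise. Then $c_\wedge(AI_n)=2^n-n-1$.
   Context: $c_\wedge(f)$ denotes the multiplicative complexity of $f$: the minimum number of AND gates in an XOR-AND circuit (gates: unbounded fan-in XOR over $\mathbb{F}_2$, fan-in-2 AND, constant 1) computing all outputs of $f$. -}

module Defs where

open import Data.Nat using (ℕ; zero; suc; _+_; _≤_)
open import Data.Bool using (Bool; true; false; _xor_; _∧_)
open import Data.Bool.Properties using () renaming (_≟_ to _≟ᵇ_)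
open import Data.Fin using (Fin)
open import Data.List using (List; foldr; map)
open import Data.Vec.Functional using (_∷_; head; tail)
open import Data.Product using (Σ; _×_)
open import Relation.Binary.PropositionalEquality using (_≡_)
open import Relation.Nullary.Decidable using (⌊_⌋)

-- Bool models 𝔽₂ (xor = addition, ∧ = multiplication, true = 1).

-- A gate in a circuit whose currently available wires are indexed by Fin w
-- (wires are the n inputs plus the outputs of all earlier gates).
data Gate (w : ℕ) : Set where
  xorG : List (Fin w) → Gate w
  andG : Fin w → Fin w → Gate w
  oneG : Gate w

evalGate : ∀ {w} → Gate w → (Fin w → Bool) → Bool
evalGate (xorG is) v = foldr _xor_ false (map v is)
evalGate (andG i j) v = v i ∧ v j
evalGate oneG v = true

-- A sequence of gates, starting with w available wires; each new gate's
-- output becomes a new wire (placed at index zero, earlier wires shifted).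
data Gates (w : ℕ) : Set where
  []  : Gates w
  _∷ᵍ_ : Gate w → Gates (suc w) → Gates w

totalWires : ∀ {w} → Gates w → ℕ
totalWires {w} [] = w
totalWires (g ∷ᵍ gs) = totalWires gs

evalGates : ∀ {w} → (gs : Gates w) → (Fin w → Bool) → Fin (totalWires gs) → Bool
evalGates [] v = v
evalGates (g ∷ᵍ gs) v = evalGates gs (evalGate g v ∷ v)

andCountG : ∀ {w} → Gate w → ℕ
andCountG (andG _ _) = 1
andCountG _ = 0

andCount : ∀ {w} → Gates w → ℕ
andCount [] = 0
andCount (g ∷ᵍ gs) = andCountG g + andCount gs

record Circuit (n : ℕ) (O : Set) : Set where
  field
    gates  : Gates n
    output : O → Fin (totalWires gates)

open Circuit public

Computes : ∀ {n} {O : Set} → Circuit n O → ((Fin n → Bool) → O → Bool) → Set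
Computes C f = ∀ x o → evalGates (gates C) x (output C o) ≡ f x o

MultComplexityIs : ∀ {n} {O : Set} → ((Fin n → Bool) → O → Bool) → ℕ → Set
MultComplexityIs {n} {O} f k =
  Σ (Circuit n O) (λ C → Computes C f × andCount (gates C) ≡ k)
  × (∀ (C : Circuit n O) → Computes C f → k ≤ andCount (gates C))

eqVec : ∀ n → (Fin n → Bool) → (Fin n → Bool) → Bool
eqVec zero x z = true
eqVec (suc n) x z = ⌊ head x ≟ᵇ head z ⌋ ∧ eqVec n (tail x) (tail z)

indicator : ∀ {n} → (Fin n → Bool) → (Fin n → Bool) → Bool
indicator {n} z x = eqVec n x z

-- AI_n(x) = (I_z(x))_{z ∈ 𝔽₂ⁿ}; outputs indexed directly by z ∈ 𝔽₂ⁿ.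
AI : ∀ n → (Fin n → Bool) → (Fin n → Bool) → Bool
AI n x z = indicator z x

module Submission where

-- Lower bound, a rank argument.  In a circuit with c AND gates every wire is
-- an 𝔽₂-linear form in the n + 1 + c "features" 1, x₁, …, xₙ, a₁, …, a_c,
-- where the aᵢ are the AND outputs (`linearize`).  On the 2^n inputs the
-- outputs I_z form an identity matrix, so the coefficient vectors of the
-- outputs and the feature vectors of the inputs are biorthogonal families of
-- size 2^n in 𝔽₂^(n+1+c); this embeds 𝔽₂^(2^n) into 𝔽₂^(n+1+c), and counting
-- elements gives 2^n ≤ n + 1 + c (`biorthogonal⇒≤`, `AI-lowerBound`).
--
-- Upper bound, the algebraic normal form.  The 2^k monomials in k variables
-- cost 2^k - k - 1 ANDs: a monomial containing x₀ is x₀ times a monomial in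
-- the other variables, and x₀ · 1 = x₀ is free (`MonomialBasis`, `basis`).
-- By the Shannon expansion they span all Boolean functions, so every I_z is
-- an XOR of monomials and needs no further AND (`AI-circuit`).

open import Defs
open import Data.Nat using (ℕ; zero; suc; _+_; _*_; _≤_; _<_; _^_; _∸_; z≤n; s≤s; _≤?_)
open import Data.Nat.Properties
  using (+-assoc; +-suc; +-identityʳ; *-zeroʳ; *-identityʳ; ∸-monoˡ-≤;
         m+n∸n≡m; ^-monoʳ-<; <⇒≱; ≰⇒>; +-commutativeSemigroup)
open import Data.Bool using (Bool; true; false; _xor_; _∧_)
open import Data.Bool.Properties
  using (xor-assoc; xor-identityʳ; xor-same; ∧-zeroʳ; ∧-identityʳ; ∧-assoc; ∧-comm;
         ∧-distribˡ-xor; ∧-distribʳ-xor; ¬-not; xor-∧-commutativeRing)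
  renaming (_≟_ to _≟ᵇ_)
open import Data.Fin using (Fin; zero; suc; _↑ˡ_; _↑ʳ_; finToFun; funToFin; combine)
open import Data.Fin.Properties using (_≟_; 2↔Bool; funToFin-finToFin; finToFun-funToFin; injective⇒≤)
open import Data.List using (List; []; _∷_; foldr; map; _++_)
open import Data.Vec.Functional using (tail) renaming (_∷_ to _∷ᶠ_; _++_ to _++ᶠ_)
open import Data.Vec.Functional.Properties using (lookup-++ˡ; lookup-++ʳ)
open import Data.Product using (Σ; _×_; _,_; proj₁; proj₂)
open import Function using (_∘_)
open import Function.Bundles using (Inverse)
open import Relation.Nullary using (does; yes; no; contradiction)
open import Relation.Nullary.Decidable using (⌊_⌋; isYes≗does; dec-true)
open import Relation.Binary.PropositionalEquality
open import Algebra.Bundles using (CommutativeRing)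
open import Algebra.Properties.CommutativeSemigroup
  (CommutativeRing.+-commutativeSemigroup xor-∧-commutativeRing) using (interchange)
open import Algebra.Properties.CommutativeSemigroup +-commutativeSemigroup
  using () renaming (xy∙z≈y∙xz to +-exchange)

open ≡-Reasoning

⨁ : ∀ N → (Fin N → Bool) → Bool
⨁ zero    f = false
⨁ (suc N) f = f zero xor ⨁ N (f ∘ suc)

⨁-cong : ∀ N {f g : Fin N → Bool} → f ≗ g → ⨁ N f ≡ ⨁ N g
⨁-cong zero    p = refl
⨁-cong (suc N) p = cong₂ _xor_ (p zero) (⨁-cong N (p ∘ suc))

⨁-false : ∀ N → ⨁ N (λ _ → false) ≡ false
⨁-false zero    = refl
⨁-false (suc N) = ⨁-false N

⨁-xor : ∀ N (f g : Fin N → Bool) → ⨁ N (λ k → f k xor g k) ≡ ⨁ N f xor ⨁ N g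
⨁-xor zero    f g = refl
⨁-xor (suc N) f g = begin
  (f zero xor g zero) xor ⨁ N (λ k → f (suc k) xor g (suc k))
    ≡⟨ cong ((f zero xor g zero) xor_) (⨁-xor N (f ∘ suc) (g ∘ suc)) ⟩
  (f zero xor g zero) xor (⨁ N (f ∘ suc) xor ⨁ N (g ∘ suc))
    ≡⟨ interchange (f zero) (g zero) _ _ ⟩
  ⨁ (suc N) f xor ⨁ (suc N) g ∎

⨁-scaleˡ : ∀ N b (f : Fin N → Bool) → b ∧ ⨁ N f ≡ ⨁ N (λ k → b ∧ f k)
⨁-scaleˡ zero    b f = ∧-zeroʳ b
⨁-scaleˡ (suc N) b f =
  trans (∧-distribˡ-xor b (f zero) _) (cong ((b ∧ f zero) xor_) (⨁-scaleˡ N b (f ∘ suc)))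

⨁-scaleʳ : ∀ N b (f : Fin N → Bool) → ⨁ N f ∧ b ≡ ⨁ N (λ k → f k ∧ b)
⨁-scaleʳ zero    b f = refl
⨁-scaleʳ (suc N) b f =
  trans (∧-distribʳ-xor b (f zero) _) (cong ((f zero ∧ b) xor_) (⨁-scaleʳ N b (f ∘ suc)))

⨁-swap : ∀ M N (f : Fin M → Fin N → Bool) →
         ⨁ M (λ j → ⨁ N (f j)) ≡ ⨁ N (λ k → ⨁ M (λ j → f j k))
⨁-swap zero    N f = sym (⨁-false N)
⨁-swap (suc M) N f =
  trans (cong (⨁ N (f zero) xor_) (⨁-swap M N (f ∘ suc)))
        (sym (⨁-xor N (f zero) (λ k → ⨁ M (λ j → f (suc j) k))))

⨁-select : ∀ N (i : Fin N) (f : Fin N → Bool) → ⨁ N (λ k → does (i ≟ k) ∧ f k) ≡ f i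
⨁-select (suc N) zero    f = trans (cong (f zero xor_) (⨁-false N)) (xor-identityʳ (f zero))
⨁-select (suc N) (suc i) f = ⨁-select N i (f ∘ suc)

dot : ∀ {N} → (Fin N → Bool) → (Fin N → Bool) → Bool
dot {N} c e = ⨁ N (λ k → c k ∧ e k)

unit : ∀ {N} → Fin N → Fin N → Bool
unit i k = does (i ≟ k)

dot-unit : ∀ {N} (i : Fin N) e → dot (unit i) e ≡ e i
dot-unit {N} i e = ⨁-select N i e

xsum : ∀ {w} → (Fin w → Bool) → List (Fin w) → Bool
xsum u is = foldr _xor_ false (map u is)

xsum-cong : ∀ {w} {u u′ : Fin w → Bool} → u ≗ u′ → ∀ is → xsum u is ≡ xsum u′ is
xsum-cong p []       = refl
xsum-cong p (i ∷ is) = cong₂ _xor_ (p i) (xsum-cong p is)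

xsum-map : ∀ {w w′} (u : Fin w′ → Bool) (ρ : Fin w → Fin w′) is → xsum u (map ρ is) ≡ xsum (u ∘ ρ) is
xsum-map u ρ []       = refl
xsum-map u ρ (i ∷ is) = cong (u (ρ i) xor_) (xsum-map u ρ is)

xsum-++ : ∀ {w} (u : Fin w → Bool) is js → xsum u (is ++ js) ≡ xsum u is xor xsum u js
xsum-++ u []       js = refl
xsum-++ u (i ∷ is) js = trans (cong (u i xor_) (xsum-++ u is js)) (sym (xor-assoc (u i) _ _))

xsum-scale : ∀ {w} b (u : Fin w → Bool) is → b ∧ xsum u is ≡ xsum (λ i → b ∧ u i) is
xsum-scale b u []       = ∧-zeroʳ b
xsum-scale b u (i ∷ is) = trans (∧-distribˡ-xor b (u i) _) (cong ((b ∧ u i) xor_) (xsum-scale b u is))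

dot-xsum : ∀ {w N} (σ : Fin w → Fin N → Bool) e is →
           dot (λ k → xsum (λ i → σ i k) is) e ≡ xsum (λ i → dot (σ i) e) is
dot-xsum {N = N} σ e []       = ⨁-false N
dot-xsum {N = N} σ e (i ∷ is) = begin
  ⨁ N (λ k → (σ i k xor xsum (λ j → σ j k) is) ∧ e k)
    ≡⟨ ⨁-cong N (λ k → ∧-distribʳ-xor (e k) (σ i k) _) ⟩
  ⨁ N (λ k → (σ i k ∧ e k) xor (xsum (λ j → σ j k) is ∧ e k))
    ≡⟨ ⨁-xor N _ _ ⟩
  dot (σ i) e xor dot (λ k → xsum (λ j → σ j k) is) e
    ≡⟨ cong (dot (σ i) e xor_) (dot-xsum σ e is) ⟩
  xsum (λ j → dot (σ j) e) (i ∷ is) ∎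

-- Bit strings of length k are enumerated by Fin (2 ^ k), via the library's
-- Fin (m ^ k) ≅ (Fin k → Fin m) and Fin 2 ≅ Bool; both directions are
-- inverse up to pointwise equality.
module Bit = Inverse 2↔Bool

toBits : ∀ k → Fin (2 ^ k) → Fin k → Bool
toBits k i = Bit.to ∘ finToFun i

fromBits : ∀ {k} → (Fin k → Bool) → Fin (2 ^ k)
fromBits x = funToFin (Bit.from ∘ x)

funToFin-cong : ∀ {m n} {f g : Fin m → Fin n} → f ≗ g → funToFin f ≡ funToFin g
funToFin-cong {zero}  p = refl
funToFin-cong {suc m} p = cong₂ combine (p zero) (funToFin-cong (p ∘ suc))

fromBits-cong : ∀ {k} {x y : Fin k → Bool} → x ≗ y → fromBits x ≡ fromBits y
fromBits-cong p = funToFin-cong (cong Bit.from ∘ p)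

toBits-fromBits : ∀ {k} (x : Fin k → Bool) → toBits k (fromBits x) ≗ x
toBits-fromBits x t = trans (cong Bit.to (finToFun-funToFin (Bit.from ∘ x) t)) (Bit.strictlyInverseˡ (x t))

fromBits-toBits : ∀ k (i : Fin (2 ^ k)) → fromBits (toBits k i) ≡ i
fromBits-toBits k i =
  trans (funToFin-cong {k} (Bit.strictlyInverseʳ ∘ finToFun i)) (funToFin-finToFin {k} i)

toBits-injective : ∀ k {i j : Fin (2 ^ k)} → toBits k i ≗ toBits k j → i ≡ j
toBits-injective k {i} {j} p =
  trans (sym (fromBits-toBits k i)) (trans (fromBits-cong p) (fromBits-toBits k j))

2^-cancel-≤ : ∀ {m n} → 2 ^ m ≤ 2 ^ n → m ≤ n
2^-cancel-≤ {m} {n} p with m ≤? n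
... | yes m≤n = m≤n
... | no  m≰n = contradiction p (<⇒≱ (^-monoʳ-< 2 (s≤s (s≤s z≤n)) (≰⇒> m≰n)))

-- Counting: if 𝔽₂^M maps into 𝔽₂^N with a retraction (respecting pointwise
-- equality), then M ≤ N, because Fin (2 ^ M) then injects into Fin (2 ^ N).
embedding⇒≤ : ∀ {M N} (c : (Fin M → Bool) → Fin N → Bool) (r : (Fin N → Bool) → Fin M → Bool) →
              (∀ {a b} → a ≗ b → r a ≗ r b) → (∀ d → r (c d) ≗ d) → M ≤ N
embedding⇒≤ {M} {N} c r r-cong retract = 2^-cancel-≤ (injective⇒≤ encode-injective)
  where
  encode : Fin (2 ^ M) → Fin (2 ^ N)
  encode i = fromBits (c (toBits M i))

  decode : ∀ i → r (toBits N (encode i)) ≗ toBits M i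
  decode i t = trans (r-cong (toBits-fromBits (c (toBits M i))) t) (retract (toBits M i) t)

  encode-injective : ∀ {i j} → encode i ≡ encode j → i ≡ j
  encode-injective {i} {j} e = toBits-injective M λ t →
    trans (sym (decode i t)) (trans (cong (λ a → r (toBits N a) t) e) (decode j t))

-- Rank bound: M vectors E i and M vectors s j in 𝔽₂^N with
-- dot (s j) (E i) = [i = j] force M ≤ N.  The map d ↦ Σⱼ dⱼ s j is then
-- retracted by v ↦ (dot v (E i))ᵢ.
biorthogonal⇒≤ : ∀ {M N} (E s : Fin M → Fin N → Bool) →
                 (∀ i j → dot (s j) (E i) ≡ does (i ≟ j)) → M ≤ N
biorthogonal⇒≤ {M} {N} E s biorth = embedding⇒≤ combination coordinates coordinates-cong recover
  where
  combination : (Fin M → Bool) → Fin N → Bool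
  combination d k = ⨁ M (λ j → d j ∧ s j k)

  coordinates : (Fin N → Bool) → Fin M → Bool
  coordinates v i = dot v (E i)

  coordinates-cong : ∀ {a b} → a ≗ b → coordinates a ≗ coordinates b
  coordinates-cong p i = ⨁-cong N (λ k → cong (_∧ E i k) (p k))

  recover : ∀ d → coordinates (combination d) ≗ d
  recover d i = begin
    ⨁ N (λ k → ⨁ M (λ j → d j ∧ s j k) ∧ E i k)
      ≡⟨ ⨁-cong N (λ k → ⨁-scaleʳ M (E i k) (λ j → d j ∧ s j k)) ⟩
    ⨁ N (λ k → ⨁ M (λ j → (d j ∧ s j k) ∧ E i k))
      ≡⟨ sym (⨁-swap M N (λ j k → (d j ∧ s j k) ∧ E i k)) ⟩
    ⨁ M (λ j → ⨁ N (λ k → (d j ∧ s j k) ∧ E i k))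
      ≡⟨ ⨁-cong M (λ j → trans (⨁-cong N (λ k → ∧-assoc (d j) (s j k) (E i k)))
                                (sym (⨁-scaleˡ N (d j) (λ k → s j k ∧ E i k)))) ⟩
    ⨁ M (λ j → d j ∧ dot (s j) (E i))
      ≡⟨ ⨁-cong M (λ j → trans (cong (d j ∧_) (biorth i j)) (∧-comm (d j) _)) ⟩
    ⨁ M (λ j → does (i ≟ j) ∧ d j)
      ≡⟨ ⨁-select M i d ⟩
    d i ∎

record LinearModel (n w N : ℕ) (v : (Fin n → Bool) → Fin w → Bool) : Set where
  field
    features    : (Fin n → Bool) → Fin N → Bool
    coeff       : Fin w → Fin N → Bool
    wire-linear : ∀ x i → v x i ≡ dot (coeff i) (features x)
    oneCoeff    : Fin N → Bool
    one-linear  : ∀ x → dot oneCoeff (features x) ≡ true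

inputModel : ∀ n → LinearModel n n (suc n) (λ x → x)
inputModel n = record
  { features    = λ x → true ∷ᶠ x
  ; coeff       = λ i → unit (suc i)
  ; wire-linear = λ x i → sym (dot-unit (suc i) (true ∷ᶠ x))
  ; oneCoeff    = unit zero
  ; one-linear  = λ x → dot-unit zero (true ∷ᶠ x)
  }

-- Adding a gate keeps the model linear: XOR and constant gates are linear in
-- the existing features, and an AND gate costs one new feature (its output).
extendModel : ∀ {n w N v} (g : Gate w) → LinearModel n w N v →
              LinearModel n (suc w) (andCountG g + N) (λ x → evalGate g (v x) ∷ᶠ v x)
extendModel (xorG is) L = record
  { features    = features
  ; coeff       = (λ k → xsum (λ i → coeff i k) is) ∷ᶠ coeff
  ; wire-linear = λ { x zero    → trans (xsum-cong (wire-linear x) is) (sym (dot-xsum coeff (features x) is))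
                    ; x (suc i) → wire-linear x i }
  ; oneCoeff    = oneCoeff
  ; one-linear  = one-linear
  }
  where open LinearModel L
extendModel {v = v} (andG i j) L = record
  { features    = λ x → (v x i ∧ v x j) ∷ᶠ features x
  ; coeff       = unit zero ∷ᶠ (λ k → false ∷ᶠ coeff k)
  ; wire-linear = λ { x zero    → sym (dot-unit zero ((v x i ∧ v x j) ∷ᶠ features x))
                    ; x (suc k) → wire-linear x k }
  ; oneCoeff    = false ∷ᶠ oneCoeff
  ; one-linear  = one-linear
  }
  where open LinearModel L
extendModel oneG L = record
  { features    = features
  ; coeff       = oneCoeff ∷ᶠ coeff
  ; wire-linear = λ { x zero → sym (one-linear x) ; x (suc i) → wire-linear x i }
  ; oneCoeff    = oneCoeff
  ; one-linear  = one-linear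
  }
  where open LinearModel L

linearize : ∀ {n w N v} (gs : Gates w) → LinearModel n w N v →
            LinearModel n (totalWires gs) (andCount gs + N) (λ x → evalGates gs (v x))
linearize [] L = L
linearize {n} {N = N} {v} (g ∷ᵍ gs) L =
  subst (λ D → LinearModel n (totalWires gs) D (λ x → evalGates gs (evalGate g (v x) ∷ᶠ v x)))
        (sym (+-exchange (andCountG g) (andCount gs) N))
        (linearize gs (extendModel g L))

eqVec-refl : ∀ n (x : Fin n → Bool) → eqVec n x x ≡ true
eqVec-refl zero    x = refl
eqVec-refl (suc n) x = trans (cong (_∧ eqVec n (tail x) (tail x)) head-equal) (eqVec-refl n (tail x))
  where
  head-equal : ⌊ x zero ≟ᵇ x zero ⌋ ≡ true
  head-equal = trans (isYes≗does (x zero ≟ᵇ x zero)) (dec-true (x zero ≟ᵇ x zero) refl)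

eqVec-sound : ∀ n (x z : Fin n → Bool) → eqVec n x z ≡ true → x ≗ z
eqVec-sound (suc n) x z e with x zero ≟ᵇ z zero
... | yes p = λ { zero → p ; (suc i) → eqVec-sound n (tail x) (tail z) e i }
... | no  _ = contradiction e λ ()

eqVec-cong : ∀ n {x x′ z z′ : Fin n → Bool} → x ≗ x′ → z ≗ z′ → eqVec n x z ≡ eqVec n x′ z′
eqVec-cong zero    p q = refl
eqVec-cong (suc n) p q =
  cong₂ _∧_ (cong₂ (λ a b → ⌊ a ≟ᵇ b ⌋) (p zero) (q zero)) (eqVec-cong n (p ∘ suc) (q ∘ suc))

AI-identity : ∀ n (i j : Fin (2 ^ n)) → AI n (toBits n i) (toBits n j) ≡ does (i ≟ j)
AI-identity n i j with i ≟ j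
... | yes refl = eqVec-refl n (toBits n i)
... | no  i≢j  = ¬-not (λ e → i≢j (toBits-injective n (eqVec-sound n _ _ e)))

AI-lowerBound : ∀ n (C : Circuit n (Fin n → Bool)) → Computes C (AI n) →
                2 ^ n ≤ andCount (gates C) + suc n
AI-lowerBound n C computes =
  biorthogonal⇒≤ (features ∘ toBits n) (coeff ∘ output C ∘ toBits n) λ i j →
    trans (sym (wire-linear (toBits n i) (output C (toBits n j))))
          (trans (computes (toBits n i) (toBits n j)) (AI-identity n i j))
  where open LinearModel (linearize (gates C) (inputModel n))

persist : ∀ {w} (gs : Gates w) → Fin w → Fin (totalWires gs)
persist []         i = i
persist (g ∷ᵍ gs) i = persist gs (suc i)

persist-ok : ∀ {w} (gs : Gates w) v i → evalGates gs v (persist gs i) ≡ v i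
persist-ok []         v i = refl
persist-ok (g ∷ᵍ gs) v i = persist-ok gs (evalGate g v ∷ᶠ v) (suc i)

_++ᵍ_ : ∀ {w} (gs : Gates w) → Gates (totalWires gs) → Gates w
[]         ++ᵍ hs = hs
(g ∷ᵍ gs) ++ᵍ hs = g ∷ᵍ (gs ++ᵍ hs)

appended : ∀ {w} (gs : Gates w) (hs : Gates (totalWires gs)) → Fin (totalWires hs) → Fin (totalWires (gs ++ᵍ hs))
appended []         hs i = i
appended (g ∷ᵍ gs) hs i = appended gs hs i

appended-ok : ∀ {w} (gs : Gates w) hs v i →
              evalGates (gs ++ᵍ hs) v (appended gs hs i) ≡ evalGates hs (evalGates gs v) i
appended-ok []         hs v i = refl
appended-ok (g ∷ᵍ gs) hs v i = appended-ok gs hs (evalGate g v ∷ᶠ v) i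

andCount-++ : ∀ {w} (gs : Gates w) hs → andCount (gs ++ᵍ hs) ≡ andCount gs + andCount hs
andCount-++ []         hs = refl
andCount-++ (g ∷ᵍ gs) hs = trans (cong (andCountG g +_) (andCount-++ gs hs)) (sym (+-assoc (andCountG g) _ _))

shiftGate : ∀ {w} → Gate w → Gate (suc w)
shiftGate (xorG is)  = xorG (map suc is)
shiftGate (andG i j) = andG (suc i) (suc j)
shiftGate oneG       = oneG

shiftGate-ok : ∀ {w} (g : Gate w) b v → evalGate (shiftGate g) (b ∷ᶠ v) ≡ evalGate g v
shiftGate-ok (xorG is)  b v = xsum-map (b ∷ᶠ v) suc is
shiftGate-ok (andG i j) b v = refl
shiftGate-ok oneG       b v = refl

andCountG-shift : ∀ {w} (g : Gate w) → andCountG (shiftGate g) ≡ andCountG g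
andCountG-shift (xorG is)  = refl
andCountG-shift (andG i j) = refl
andCountG-shift oneG       = refl

layer : ∀ {w} K → (Fin K → Gate w) → Gates w
layer zero    G = []
layer (suc K) G = G zero ∷ᵍ layer K (shiftGate ∘ G ∘ suc)

layerWire : ∀ {w K} (G : Fin K → Gate w) → Fin K → Fin (totalWires (layer K G))
layerWire {K = suc K} G zero    = persist (layer K (shiftGate ∘ G ∘ suc)) zero
layerWire {K = suc K} G (suc k) = layerWire (shiftGate ∘ G ∘ suc) k

layer-ok : ∀ {w K} (G : Fin K → Gate w) v k → evalGates (layer K G) v (layerWire G k) ≡ evalGate (G k) v
layer-ok {K = suc K} G v zero    = persist-ok (layer K (shiftGate ∘ G ∘ suc)) _ zero
layer-ok {K = suc K} G v (suc k) =
  trans (layer-ok (shiftGate ∘ G ∘ suc) (evalGate (G zero) v ∷ᶠ v) k) (shiftGate-ok (G (suc k)) _ v)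

andCount-layer : ∀ {w} K (G : Fin K → Gate w) c → (∀ k → andCountG (G k) ≡ c) → andCount (layer K G) ≡ K * c
andCount-layer zero    G c p = refl
andCount-layer (suc K) G c p =
  cong₂ _+_ (p zero) (andCount-layer K (shiftGate ∘ G ∘ suc) c (λ k → trans (andCountG-shift (G (suc k))) (p (suc k))))

Extensional : ∀ {k} → ((Fin k → Bool) → Bool) → Set
Extensional {k} h = ∀ {x y : Fin k → Bool} → x ≗ y → h x ≡ h y

shannon : ∀ {k} (h : (Fin (suc k) → Bool) → Bool) b t →
          h (b ∷ᶠ t) ≡ h (false ∷ᶠ t) xor (b ∧ (h (false ∷ᶠ t) xor h (true ∷ᶠ t)))
shannon h false t = sym (xor-identityʳ _)
shannon h true  t = begin
  h (true ∷ᶠ t)                                  ≡⟨ cong (_xor h (true ∷ᶠ t)) (xor-same (h (false ∷ᶠ t))) ⟨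
  (h (false ∷ᶠ t) xor h (false ∷ᶠ t)) xor h (true ∷ᶠ t) ≡⟨ xor-assoc (h (false ∷ᶠ t)) _ _ ⟩
  h (false ∷ᶠ t) xor (h (false ∷ᶠ t) xor h (true ∷ᶠ t)) ∎

Represents : ∀ {w m} (gs : Gates w) → (Fin m → Fin (totalWires gs)) → Fin w →
             ((Fin w → Bool) → Bool) → List (Fin m) → Set
Represents gs family one F L = ∀ v → v one ≡ true → xsum (evalGates gs v ∘ family) L ≡ F v

record MonomialBasis {w} (k : ℕ) (vars : Fin k → Fin w) (one : Fin w) : Set where
  field
    body      : Gates w
    size      : ℕ
    mono      : Fin (suc size) → Fin (totalWires body)
    mono-one  : ∀ v → v one ≡ true → evalGates body v (mono zero) ≡ true
    spans     : ∀ h → Extensional h → Σ (List (Fin (suc size))) (Represents body mono one λ v → h (v ∘ vars))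
    ands      : andCount body + k ≡ size
    size-pow  : suc size ≡ 2 ^ k

basis₀ : ∀ {w} (vars : Fin 0 → Fin w) one → MonomialBasis 0 vars one
basis₀ {w} vars one = record
  { body = [] ; size = 0 ; mono = λ _ → one ; mono-one = λ v e → e
  ; spans = λ h h-ext → constant (h λ ()) , λ v e → trans (constant-ok (h λ ()) v e) (h-ext λ ())
  ; ands = refl ; size-pow = refl }
  where
  constant : Bool → List (Fin 1)
  constant true  = zero ∷ []
  constant false = []

  constant-ok : ∀ b (v : Fin w → Bool) → v one ≡ true → xsum (λ _ → v one) (constant b) ≡ b
  constant-ok true  v e = trans (xor-identityʳ (v one)) e
  constant-ok false v e = refl

-- One more variable x₀ = vars zero: keep the monomials m of the other
-- variables and add the monomials x₀ ∧ m, one AND gate for each m ≠ 1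
-- (x₀ ∧ 1 is the wire x₀ itself).
module BasisStep {w k} {vars : Fin (suc k) → Fin w} {one : Fin w}
                 (B : MonomialBasis k (vars ∘ suc) one) where
  open MonomialBasis B

  x₀ : Fin (totalWires body)
  x₀ = persist body (vars zero)

  products : Gates (totalWires body)
  products = layer size (λ j → andG x₀ (mono (suc j)))

  body′ : Gates w
  body′ = body ++ᵍ products

  old : Fin (suc size) → Fin (totalWires body′)
  old i = appended body products (persist products (mono i))

  new : Fin (suc size) → Fin (totalWires body′)
  new zero    = appended body products (persist products x₀)
  new (suc j) = appended body products (layerWire _ j)

  mono′ : Fin (suc size + suc size) → Fin (totalWires body′)
  mono′ = old ++ᶠ new

  old-ok : ∀ v i → evalGates body′ v (old i) ≡ evalGates body v (mono i)
  old-ok v i = trans (appended-ok body products v _) (persist-ok products _ (mono i))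

  new-ok : ∀ v → v one ≡ true → ∀ i → evalGates body′ v (new i) ≡ v (vars zero) ∧ evalGates body v (mono i)
  new-ok v e zero = begin
    evalGates body′ v (new zero)                ≡⟨ appended-ok body products v _ ⟩
    evalGates products u (persist products x₀)  ≡⟨ persist-ok products u x₀ ⟩
    u x₀                                        ≡⟨ persist-ok body v (vars zero) ⟩
    v (vars zero)                               ≡⟨ ∧-identityʳ _ ⟨
    v (vars zero) ∧ true                        ≡⟨ cong (v (vars zero) ∧_) (mono-one v e) ⟨
    v (vars zero) ∧ u (mono zero)               ∎
    where
    u : Fin (totalWires body) → Bool
    u = evalGates body v
  new-ok v e (suc j) =
    trans (appended-ok body products v _)
          (trans (layer-ok _ (evalGates body v) j) (cong (_∧ _) (persist-ok body v (vars zero))))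

  mono′-old : ∀ v i → evalGates body′ v (mono′ (i ↑ˡ suc size)) ≡ evalGates body v (mono i)
  mono′-old v i = trans (cong (evalGates body′ v) (lookup-++ˡ old new i)) (old-ok v i)

  mono′-new : ∀ v → v one ≡ true → ∀ i →
              evalGates body′ v (mono′ (suc size ↑ʳ i)) ≡ v (vars zero) ∧ evalGates body v (mono i)
  mono′-new v e i = trans (cong (evalGates body′ v) (lookup-++ʳ old new i)) (new-ok v e i)

  -- By the Shannon expansion h = h₀ ⊕ x₀ · h₁ with h₀, h₁ functions of the
  -- other variables: represent h₀ by old monomials and x₀ · h₁ by new ones.
  spans′ : ∀ h → Extensional h →
           Σ (List (Fin (suc size + suc size))) (Represents body′ mono′ one λ v → h (v ∘ vars))
  spans′ h h-ext = map (_↑ˡ suc size) L₀ ++ map (suc size ↑ʳ_) L₁ , expansion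
    where
    h₀ : (Fin k → Bool) → Bool
    h₀ t = h (false ∷ᶠ t)

    h₁ : (Fin k → Bool) → Bool
    h₁ t = h (false ∷ᶠ t) xor h (true ∷ᶠ t)

    cons-cong : ∀ b {x y : Fin k → Bool} → x ≗ y → (b ∷ᶠ x) ≗ (b ∷ᶠ y)
    cons-cong b p zero    = refl
    cons-cong b p (suc i) = p i

    span₀ : Σ (List (Fin (suc size))) (Represents body mono one λ v → h₀ (v ∘ vars ∘ suc))
    span₀ = spans h₀ (λ p → h-ext (cons-cong false p))

    span₁ : Σ (List (Fin (suc size))) (Represents body mono one λ v → h₁ (v ∘ vars ∘ suc))
    span₁ = spans h₁ (λ p → cong₂ _xor_ (h-ext (cons-cong false p)) (h-ext (cons-cong true p)))

    L₀ L₁ : List (Fin (suc size))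
    L₀ = proj₁ span₀
    L₁ = proj₁ span₁

    expansion : Represents body′ mono′ one (λ v → h (v ∘ vars)) (map (_↑ˡ suc size) L₀ ++ map (suc size ↑ʳ_) L₁)
    expansion v e = begin
      xsum u (map (_↑ˡ suc size) L₀ ++ map (suc size ↑ʳ_) L₁)
        ≡⟨ xsum-++ u (map (_↑ˡ suc size) L₀) (map (suc size ↑ʳ_) L₁) ⟩
      xsum u (map (_↑ˡ suc size) L₀) xor xsum u (map (suc size ↑ʳ_) L₁)
        ≡⟨ cong₂ _xor_ (trans (xsum-map u _ L₀) (xsum-cong (mono′-old v) L₀))
                       (trans (xsum-map u _ L₁) (xsum-cong (mono′-new v e) L₁)) ⟩
      xsum (evalGates body v ∘ mono) L₀ xor xsum (λ i → x ∧ evalGates body v (mono i)) L₁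
        ≡⟨ cong₂ _xor_ (proj₂ span₀ v e) (trans (sym (xsum-scale x _ L₁)) (cong (x ∧_) (proj₂ span₁ v e))) ⟩
      h₀ t xor (x ∧ h₁ t)
        ≡⟨ shannon h x t ⟨
      h (x ∷ᶠ t)
        ≡⟨ h-ext (λ { zero → refl ; (suc i) → refl }) ⟩
      h (v ∘ vars) ∎
      where
      u : Fin (suc size + suc size) → Bool
      u = evalGates body′ v ∘ mono′
      x : Bool
      x = v (vars zero)
      t : Fin k → Bool
      t = v ∘ vars ∘ suc

  ands′ : andCount body′ + suc k ≡ size + suc size
  ands′ = begin
    andCount (body ++ᵍ products) + suc k    ≡⟨ cong (_+ suc k) (andCount-++ body products) ⟩
    (andCount body + andCount products) + suc k
      ≡⟨ cong (λ p → (andCount body + p) + suc k)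
              (trans (andCount-layer size _ 1 (λ _ → refl)) (*-identityʳ size)) ⟩
    (andCount body + size) + suc k          ≡⟨ +-exchange (andCount body) size (suc k) ⟩
    size + (andCount body + suc k)          ≡⟨ cong (size +_) (trans (+-suc _ k) (cong suc ands)) ⟩
    size + suc size                         ∎

  extended : MonomialBasis (suc k) vars one
  extended = record
    { body     = body′
    ; size     = size + suc size
    ; mono     = mono′
    ; mono-one = λ v e → trans (mono′-old v zero) (mono-one v e)
    ; spans    = spans′
    ; ands     = ands′
    ; size-pow = cong₂ _+_ size-pow (trans size-pow (sym (+-identityʳ _)))
    }

basis : ∀ {w} k (vars : Fin k → Fin w) one → MonomialBasis k vars one
basis zero    vars one = basis₀ vars one
basis (suc k) vars one = BasisStep.extended (basis k (vars ∘ suc) one)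

indicator-ext : ∀ {n} (z : Fin n → Bool) → Extensional (indicator z)
indicator-ext {n} z p = eqVec-cong n p (λ _ → refl)

AI-circuit : ∀ n → Σ (Circuit n (Fin n → Bool)) λ C →
             Computes C (AI n) × andCount (gates C) + suc n ≡ 2 ^ n
AI-circuit n = record { gates = oneG ∷ᵍ (body ++ᵍ xors) ; output = outWire } , computes , count
  where
  open MonomialBasis (basis n suc zero)

  anf : ∀ z → Σ (List (Fin (suc size))) (Represents body mono zero λ v → indicator z (v ∘ suc))
  anf z = spans (indicator z) (indicator-ext z)

  xorGate : Fin (2 ^ n) → Gate (totalWires body)
  xorGate i = xorG (map mono (proj₁ (anf (toBits n i))))

  xors : Gates (totalWires body)
  xors = layer (2 ^ n) xorGate

  outWire : (Fin n → Bool) → Fin (totalWires (body ++ᵍ xors))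
  outWire z = appended body xors (layerWire xorGate (fromBits z))

  computes : ∀ x z → evalGates (body ++ᵍ xors) (true ∷ᶠ x) (outWire z) ≡ AI n x z
  computes x z = begin
    evalGates (body ++ᵍ xors) (true ∷ᶠ x) (outWire z)  ≡⟨ appended-ok body xors (true ∷ᶠ x) _ ⟩
    evalGates xors u (layerWire xorGate (fromBits z))  ≡⟨ layer-ok xorGate u (fromBits z) ⟩
    xsum u (map mono (proj₁ (anf z′)))                 ≡⟨ xsum-map u mono (proj₁ (anf z′)) ⟩
    xsum (u ∘ mono) (proj₁ (anf z′))                   ≡⟨ proj₂ (anf z′) (true ∷ᶠ x) refl ⟩
    indicator z′ x                                     ≡⟨ eqVec-cong n (λ _ → refl) (toBits-fromBits z) ⟩
    AI n x z                                           ∎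
    where
    u : Fin (totalWires body) → Bool
    u = evalGates body (true ∷ᶠ x)
    z′ : Fin n → Bool
    z′ = toBits n (fromBits z)

  count : andCount (body ++ᵍ xors) + suc n ≡ 2 ^ n
  count = begin
    andCount (body ++ᵍ xors) + suc n         ≡⟨ cong (_+ suc n) (andCount-++ body xors) ⟩
    (andCount body + andCount xors) + suc n
      ≡⟨ cong (λ c → (andCount body + c) + suc n)
              (trans (andCount-layer (2 ^ n) xorGate 0 (λ _ → refl)) (*-zeroʳ (2 ^ n))) ⟩
    (andCount body + 0) + suc n              ≡⟨ cong (_+ suc n) (+-identityʳ _) ⟩
    andCount body + suc n                    ≡⟨ +-suc _ n ⟩
    suc (andCount body + n)                  ≡⟨ cong suc ands ⟩
    suc size                                 ≡⟨ size-pow ⟩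
    2 ^ n                                    ∎

cancel-suc : ∀ c n → c + suc n ∸ n ∸ 1 ≡ c
cancel-suc c n = trans (cong (λ m → m ∸ n ∸ 1) (+-suc c n)) (cong (_∸ 1) (m+n∸n≡m (suc c) n))

mainTheorem10 : (n : ℕ) → 1 < n → MultComplexityIs (AI n) (2 ^ n ∸ n ∸ 1)
mainTheorem10 n _ with AI-circuit n
... | C , computes , count = (C , computes , exact) , optimal
  where
  exact : andCount (gates C) ≡ 2 ^ n ∸ n ∸ 1
  exact = trans (sym (cancel-suc (andCount (gates C)) n)) (cong (λ m → m ∸ n ∸ 1) count)

  optimal : ∀ C′ → Computes C′ (AI n) → 2 ^ n ∸ n ∸ 1 ≤ andCount (gates C′)
  optimal C′ computes′ =
    subst (2 ^ n ∸ n ∸ 1 ≤_) (cancel-suc (andCount (gates C′)) n)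
          (∸-monoˡ-≤ 1 (∸-monoˡ-≤ n (AI-lowerBound n C′ computes′)))
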